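{- Let $G$ be a connected bridgeless graph and $u$ a center of $G$. For every integer $0\leq i\leq rad(G)-1$ and every leg $e$ of $N_i[u]$, there exists an optimal $(N_i[u],e)$-ear of length at most $\min\{2(rad(G)-i)+1,\eta(G)\}$.
   Context: Graphs are finite and simple. A center of $G$ is a vertex $u$ whose eccentricity $\max_y d(u,y)$ equals $rad(G)$. $N_i(u)$ (resp. $N_i[u]$) is the set of vertices at distance exactly (resp. at most) $i$ from $u$. For a vertex set $S$, the legs of $S$ are the edges between $S$ and $V(G)\setminus S$. An $S$-ear is a path $P=(u_0,u_1,\dots,u_k)$ with $V(P)\cap S=\{u_0,u_k\}$ (possibly $u_0=u_k$, in which case it is a closed ear, i.e. a cycle meeting $S$ only at $u_0$); its length is $k$. For a leg $e$ of $S$, an optimal $(S,e)$-ear is an $S$-ear containing $e$ of minimum possible length. $\eta(G)$ is the smallest integer such that every edge lies on a cycle of length at most $\eta(G)$. -}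

module Defs where

open import Data.Nat using (ℕ; zero; suc; _≤_; _<_; _+_; _*_; _∸_; _⊓_)
open import Data.Fin using (Fin)
open import Data.Bool using (Bool; true)
open import Data.List using (List; []; _∷_; _++_; [_]; length)
open import Data.List.Relation.Unary.All using (All)
open import Data.List.Relation.Unary.Linked using (Linked)
open import Data.List.Relation.Unary.Unique.Propositional using (Unique)
open import Data.Product using (Σ; ∃; _×_; _,_)
open import Data.Sum using (_⊎_)
open import Relation.Nullary using (¬_)
open import Relation.Binary.PropositionalEquality using (_≡_; _≢_)

record Graph : Set where
  field
    n     : ℕ
    adj   : Fin n → Fin n → Bool
    sym   : ∀ x y → adj x y ≡ adj y x
    irrefl : ∀ x → ¬ (adj x x ≡ true)

open Graph public

Vertex : Graph → Set
Vertex G = Fin (n G)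

Adj : (G : Graph) → Vertex G → Vertex G → Set
Adj G x y = adj G x y ≡ true

SameEdge : {A : Set} → A → A → A → A → Set
SameEdge a b x y = (a ≡ x × b ≡ y) ⊎ (a ≡ y × b ≡ x)

data Walk (G : Graph) : Vertex G → Vertex G → ℕ → Set where
  here : ∀ {u} → Walk G u u 0
  step : ∀ {u w v d} → Adj G u w → Walk G w v d → Walk G u v (suc d)

data WalkAvoiding (G : Graph) (x y : Vertex G) : Vertex G → Vertex G → Set where
  here : ∀ {u} → WalkAvoiding G x y u u
  step : ∀ {u w v} → Adj G u w → ¬ SameEdge u w x y →
         WalkAvoiding G x y w v → WalkAvoiding G x y u v

Connected : Graph → Set
Connected G = ∀ u v → ∃ λ d → Walk G u v d

-- an edge xy is a bridge iff deleting it disconnects x from y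
IsBridge : (G : Graph) → Vertex G → Vertex G → Set
IsBridge G x y = Adj G x y × ¬ WalkAvoiding G x y x y

Bridgeless : Graph → Set
Bridgeless G = ∀ x y → ¬ IsBridge G x y

Dist : (G : Graph) → Vertex G → Vertex G → ℕ → Set
Dist G u v d = Walk G u v d × (∀ d' → Walk G u v d' → d ≤ d')

Ecc : (G : Graph) → Vertex G → ℕ → Set
Ecc G u e = (∀ y → ∃ λ d → Dist G u y d × d ≤ e) × (∃ λ y → Dist G u y e)

IsRadius : Graph → ℕ → Set
IsRadius G r = (∃ λ u → Ecc G u r) × (∀ v e → Ecc G v e → r ≤ e)

IsCenter : (G : Graph) → Vertex G → Set
IsCenter G u = ∃ λ r → IsRadius G r × Ecc G u r

-- N_i[u] as a vertex predicate
Ball : (G : Graph) → Vertex G → ℕ → Vertex G → Set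
Ball G u i v = ∃ λ d → d ≤ i × Dist G u v d

IsLeg : (G : Graph) → (Vertex G → Set) → Vertex G → Vertex G → Set
IsLeg G S x y = Adj G x y × S x × ¬ S y

data HasEdge {A : Set} (x y : A) : List A → Set where
  hd : ∀ {a b xs} → SameEdge a b x y → HasEdge x y (a ∷ b ∷ xs)
  tl : ∀ {a xs} → HasEdge x y xs → HasEdge x y (a ∷ xs)

record PathData (G : Graph) : Set where
  constructor mkPath
  field
    start  : Vertex G
    inner  : List (Vertex G)
    end    : Vertex G

open PathData public

vertices : {G : Graph} → PathData G → List (Vertex G)
vertices P = start P ∷ (inner P ++ [ end P ])

pathLength : {G : Graph} → PathData G → ℕ
pathLength P = suc (length (inner P))

-- S-ear: open (a path with distinct endpoints) or closed (a cycle through u0),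
-- meeting S exactly in its endpoints.
IsEar : (G : Graph) → (Vertex G → Set) → PathData G → Set
IsEar G S P =
  Linked (Adj G) (vertices P) × S (start P) × S (end P) × All (λ v → ¬ S v) (inner P) ×
  ((start P ≢ end P × Unique (vertices P)) ⊎
   (start P ≡ end P × Unique (start P ∷ inner P) × 2 ≤ length (inner P)))

ContainsEdge : {G : Graph} → PathData G → Vertex G → Vertex G → Set
ContainsEdge P x y = HasEdge x y (vertices P)

IsOptimalEar : (G : Graph) → (Vertex G → Set) → Vertex G → Vertex G → PathData G → Set
IsOptimalEar G S x y P =
  IsEar G S P × ContainsEdge P x y ×
  (∀ Q → IsEar G S Q → ContainsEdge Q x y → pathLength P ≤ pathLength Q)

IsCycle : (G : Graph) → PathData G → Set
IsCycle G C = Linked (Adj G) (vertices C) × start C ≡ end C ×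
              Unique (start C ∷ inner C) × 2 ≤ length (inner C)

EveryEdgeOnCycleAtMost : Graph → ℕ → Set
EveryEdgeOnCycleAtMost G h = ∀ x y → Adj G x y →
  ∃ λ C → IsCycle G C × ContainsEdge C x y × pathLength C ≤ h

IsEta : Graph → ℕ → Set
IsEta G h = EveryEdgeOnCycleAtMost G h × (∀ h' → EveryEdgeOnCycleAtMost G h' → h ≤ h')

-- Let S = N_i[u] and let xy be a leg of S with x ∈ S, y ∉ S. Deleting its two boundary edges turns an
-- S-ear through xy into an escape: a path y = w₀, …, w_k outside S whose last vertex has a
-- neighbour in S. This correspondence preserves length up to 2 (ear⇒escape, escape⇒ear), so a
-- shortest escape, which exists by bounded search since escapes of each length are decidable, gives
-- an optimal ear of length k + 2 (optimal-ear). Two escapes bound k: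
--  * a cycle of length at most η(G) through xy, followed from y until it first re-enters S,
--    gives k + 2 ≤ η(G) (cycle⇒escape);
--  * if k ≥ 2(r − i), the vertex p at position r − i of a shortest escape lies at distance at most r
--    from u, so a shortest walk from u to p leaves S less than r − i steps before p; turning back
--    along it from p gives an escape of length below 2(r − i), and if it leaves S along xy itself it
--    even shortcuts the escape (radius-bound).
module Submission where

open import Defs
open import Axiom.UniquenessOfIdentityProofs using (module Decidable⇒UIP)
import Data.Bool as Bool
open import Data.Bool using (true)
open import Data.Empty using (⊥-elim)
open import Data.Fin using () renaming (_≟_ to _≟v_)
open import Data.Fin.Properties using (any?)
open import Data.List using (List; []; _∷_; _++_; [_]; _∷ʳ_; length; reverse)
open import Data.List.Properties using (++-assoc; length-++; length-reverse; unfold-reverse; reverse-++; ∷-injective)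
open import Data.List.Membership.Propositional using (_∈_)
open import Data.List.Membership.Propositional.Properties using (∈-++⁺ˡ; ∈-++⁺ʳ)
open import Data.List.Relation.Binary.Permutation.Propositional using (_↭_; ↭-sym; ↭⇒↭ₛ)
open import Data.List.Relation.Binary.Permutation.Propositional.Properties using (++-comm; ↭-reverse; All-resp-↭)
import Data.List.Relation.Binary.Permutation.Setoid.Properties as PermutationSetoid
open import Data.List.Relation.Binary.Subset.Propositional using (_⊆_)
open import Data.List.Relation.Unary.All as All using (All; []; _∷_)
open import Data.List.Relation.Unary.All.Properties using (++⁻ˡ; ¬Any⇒All¬; anti-mono) renaming (++⁺ to All-++⁺)
open import Data.List.Relation.Unary.AllPairs using ([]; _∷_)
open import Data.List.Relation.Unary.Any using (here; there)
open import Data.List.Relation.Unary.Linked using (Linked; []; [-]; _∷_)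
open import Data.List.Relation.Unary.Unique.Propositional using (Unique)
open import Data.List.Relation.Unary.Unique.Propositional.Properties using () renaming (++⁺ to unique-++⁺)
open import Data.Nat using (ℕ; zero; suc; _≤_; _<_; _+_; _*_; _∸_; _⊓_; z≤n; s≤s; _≤?_)
open import Data.Nat.Properties
open import Data.Product using (Σ; ∃; _×_; _,_; proj₁; proj₂)
open import Data.Sum using (_⊎_; inj₁; inj₂; [_,_]′)
open import Relation.Binary.PropositionalEquality
  using (_≡_; _≢_; refl; trans; cong; subst; subst₂; setoid; module ≡-Reasoning) renaming (sym to sym≡)
open import Relation.Nullary using (¬_; Dec; yes; no)
open import Relation.Nullary.Decidable using (_×-dec_; _⊎-dec_; ¬?)

Least : (ℕ → Set) → ℕ → Set
Least P m = P m × (∀ j → j < m → ¬ P j)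

least-≤ : ∀ {P : ℕ → Set} {m} → Least P m → ∀ {j} → P j → m ≤ j
least-≤ {m = m} (_ , below) {j} pj with m ≤? j
... | yes m≤j = m≤j
... | no m≰j = ⊥-elim (below j (≰⇒> m≰j) pj)

module _ {P : ℕ → Set} (P? : ∀ k → Dec (P k)) where

  searchUpTo : ∀ k → (∃ λ m → m ≤ k × Least P m) ⊎ (∀ j → j ≤ k → ¬ P j)
  searchUpTo zero with P? zero
  ... | yes p = inj₁ (0 , z≤n , p , λ _ ())
  ... | no ¬p = inj₂ λ { zero _ → ¬p }
  searchUpTo (suc k) with searchUpTo k
  ... | inj₁ (m , m≤k , l) = inj₁ (m , m≤n⇒m≤1+n m≤k , l)
  ... | inj₂ none with P? (suc k)
  ...   | yes p = inj₁ (suc k , ≤-refl , p , λ j j<1+k → none j (≤-pred j<1+k))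
  ...   | no ¬p = inj₂ λ j j≤1+k pj →
          [ (λ j<1+k → none j (≤-pred j<1+k) pj) , (λ j≡1+k → ¬p (subst P j≡1+k pj)) ]′ (m≤n⇒m<n∨m≡n j≤1+k)

  least : ∀ {k} → P k → ∃ λ m → m ≤ k × Least P m
  least {k} p with searchUpTo k
  ... | inj₁ found = found
  ... | inj₂ none = ⊥-elim (none k ≤-refl p)

module _ {A : Set} where

  unique-↭ : {xs ys : List A} → xs ↭ ys → Unique xs → Unique ys
  unique-↭ p = PermutationSetoid.Unique-resp-↭ (setoid A) (↭⇒↭ₛ p)

  unique-rotate : ∀ xs {ys : List A} → Unique (xs ++ ys) → Unique (ys ++ xs)
  unique-rotate xs {ys} = unique-↭ (++-comm xs ys)

  unique-reverse : ∀ (xs : List A) → Unique xs → Unique (reverse xs)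
  unique-reverse xs = unique-↭ (↭-sym (↭-reverse xs))

  all-reverse : ∀ {P : A → Set} (xs : List A) → All P xs → All P (reverse xs)
  all-reverse xs = All-resp-↭ (↭-sym (↭-reverse xs))

  unique-++ˡ : ∀ xs {ys : List A} → Unique (xs ++ ys) → Unique xs
  unique-++ˡ [] _ = []
  unique-++ˡ (x ∷ xs) (x∉ ∷ u) = ++⁻ˡ xs x∉ ∷ unique-++ˡ xs u

  reverse-∷-∷ʳ : ∀ (a : A) xs b → reverse (a ∷ xs ∷ʳ b) ≡ b ∷ reverse xs ∷ʳ a
  reverse-∷-∷ʳ a xs b = trans (reverse-++ (a ∷ xs) [ b ]) (cong (b ∷_) (unfold-reverse a xs))

  length-∷ʳ : ∀ (xs : List A) a → length (xs ∷ʳ a) ≡ suc (length xs)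
  length-∷ʳ xs a = trans (length-++ xs) (+-comm (length xs) 1)

  module _ {R : A → A → Set} where

    linked-++ˡ : ∀ xs {ys} → Linked R (xs ++ ys) → Linked R xs
    linked-++ˡ [] _ = []
    linked-++ˡ (a ∷ []) _ = [-]
    linked-++ˡ (a ∷ b ∷ xs) (r ∷ l) = r ∷ linked-++ˡ (b ∷ xs) l

    linked-++ʳ : ∀ xs {ys} → Linked R (xs ++ ys) → Linked R ys
    linked-++ʳ [] l = l
    linked-++ʳ (a ∷ []) [-] = []
    linked-++ʳ (a ∷ []) (_ ∷ l) = l
    linked-++ʳ (a ∷ b ∷ xs) (_ ∷ l) = linked-++ʳ (b ∷ xs) l

    linked-join : ∀ xs {c ys} → Linked R (xs ∷ʳ c) → Linked R (c ∷ ys) → Linked R (xs ++ c ∷ ys)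
    linked-join [] _ l = l
    linked-join (a ∷ []) (r ∷ _) l = r ∷ l
    linked-join (a ∷ b ∷ xs) (r ∷ l₁) l = r ∷ linked-join (b ∷ xs) l₁ l

    linked-reverse : (∀ {a b} → R a b → R b a) → ∀ xs → Linked R xs → Linked R (reverse xs)
    linked-reverse sym [] _ = []
    linked-reverse sym (a ∷ []) _ = [-]
    linked-reverse sym (a ∷ b ∷ xs) (r ∷ l) =
      subst (Linked R) (sym≡ reversed) (linked-join (reverse xs) tail-reversed (sym r ∷ [-]))
      where
      tail-reversed : Linked R (reverse xs ∷ʳ b)
      tail-reversed = subst (Linked R) (unfold-reverse b xs) (linked-reverse sym (b ∷ xs) l)
      reversed : reverse (a ∷ b ∷ xs) ≡ reverse xs ++ b ∷ [ a ]
      reversed = trans (unfold-reverse a (b ∷ xs))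
                       (trans (cong (_∷ʳ a) (unfold-reverse b xs)) (++-assoc (reverse xs) [ b ] [ a ]))

  snoc-split : ∀ (xs ys : List A) a b zs c → xs ∷ʳ c ≡ ys ++ a ∷ b ∷ zs →
    (zs ≡ [] × b ≡ c × xs ≡ ys ∷ʳ a) ⊎ (∃ λ zs' → zs ≡ zs' ∷ʳ c × xs ≡ ys ++ a ∷ b ∷ zs')
  snoc-split [] [] a b zs c ()
  snoc-split [] (_ ∷ []) a b zs c ()
  snoc-split [] (_ ∷ _ ∷ _) a b zs c ()
  snoc-split (_ ∷ []) [] a b zs c refl = inj₁ (refl , refl , refl)
  snoc-split (_ ∷ _ ∷ xs) [] a b zs c refl = inj₂ (xs , refl , refl)
  snoc-split (x ∷ xs) (_ ∷ ys) a b zs c eq with ∷-injective eq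
  ... | refl , eq' with snoc-split xs ys a b zs c eq'
  ...   | inj₁ (e₁ , e₂ , e₃) = inj₁ (e₁ , e₂ , cong (x ∷_) e₃)
  ...   | inj₂ (zs' , e₁ , e₂) = inj₂ (zs' , e₁ , cong (x ∷_) e₂)

  rotate-closed : ∀ {R : A → A → Set} c inner ys zs a b → 1 ≤ length inner →
    Linked R (c ∷ inner ++ [ c ]) → Unique (c ∷ inner) → c ∷ inner ++ [ c ] ≡ ys ++ a ∷ b ∷ zs →
    ∃ λ M → Linked R (b ∷ M ++ [ a ]) × Unique (b ∷ M ++ [ a ]) × suc (length M) ≡ length inner
  rotate-closed _ [] _ _ _ _ () _ _ _
  rotate-closed c (i ∷ is) [] zs a b _ (_ ∷ l) u refl = is , l , unique-rotate [ c ] u , refl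
  rotate-closed {R} c inner (_ ∷ ys) zs a b _ l u eq with snoc-split inner ys a b zs c (proj₂ (∷-injective eq))
  ... | inj₁ (refl , refl , refl) = ys , linked-++ˡ (c ∷ ys ++ [ a ]) l , u , sym≡ (length-∷ʳ ys a)
  ... | inj₂ (zs' , refl , refl) = zs' ++ c ∷ ys , linked , unique , len
    where
    regroup : ∀ (xs : List A) → c ∷ (ys ++ a ∷ b ∷ zs') ++ xs ≡ (c ∷ ys ++ [ a ]) ++ b ∷ zs' ++ xs
    regroup xs = cong (c ∷_) (trans (++-assoc ys (a ∷ b ∷ zs') xs) (sym≡ (++-assoc ys [ a ] (b ∷ zs' ++ xs))))
    reassoc : b ∷ zs' ++ c ∷ ys ++ [ a ] ≡ b ∷ (zs' ++ c ∷ ys) ++ [ a ]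
    reassoc = cong (b ∷_) (sym≡ (++-assoc zs' (c ∷ ys) [ a ]))
    halves : Linked R ((c ∷ ys ++ [ a ]) ++ b ∷ zs' ++ [ c ])
    halves = subst (Linked R) (regroup [ c ]) l
    linked : Linked R (b ∷ (zs' ++ c ∷ ys) ++ [ a ])
    linked = subst (Linked R) reassoc
      (linked-join (b ∷ zs') (linked-++ʳ (c ∷ ys ++ [ a ]) halves) (linked-++ˡ (c ∷ ys ++ [ a ]) halves))
    unique : Unique (b ∷ (zs' ++ c ∷ ys) ++ [ a ])
    unique = subst Unique reassoc (unique-rotate (c ∷ ys ++ [ a ]) (subst Unique (cong (c ∷_) (sym≡ (++-assoc ys [ a ] (b ∷ zs')))) u))
    len : suc (length (zs' ++ c ∷ ys)) ≡ length (ys ++ a ∷ b ∷ zs')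
    len = begin
      suc (length (zs' ++ c ∷ ys))        ≡⟨ cong suc (length-++ zs') ⟩
      suc (length zs' + suc (length ys))  ≡⟨ cong suc (+-suc (length zs') (length ys)) ⟩
      suc (suc (length zs' + length ys))  ≡⟨ cong (λ m → suc (suc m)) (+-comm (length zs') (length ys)) ⟩
      suc (suc (length ys + length zs'))  ≡⟨ cong suc (sym≡ (+-suc (length ys) (length zs'))) ⟩
      suc (length ys + suc (length zs'))  ≡⟨ sym≡ (+-suc (length ys) (suc (length zs'))) ⟩
      length ys + suc (suc (length zs'))  ≡⟨ sym≡ (length-++ ys) ⟩
      length (ys ++ a ∷ b ∷ zs')          ∎
      where open ≡-Reasoning

edge-split : ∀ {A : Set} {x y : A} {l} → HasEdge x y l →
  ∃ λ ys → ∃ λ zs → ∃ λ a → ∃ λ b → l ≡ ys ++ a ∷ b ∷ zs × SameEdge a b x y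
edge-split (hd {a} {b} {zs} same) = [] , zs , a , b , refl , same
edge-split (tl {a} h) with edge-split h
... | ys , zs , a' , b' , eq , same = a ∷ ys , zs , a' , b' , cong (a ∷_) eq , same

module Walks (G : Graph) where

  V : Set
  V = Vertex G

  adj? : (a b : V) → Dec (Adj G a b)
  adj? a b = adj G a b Bool.≟ true

  open import Data.List.Membership.DecPropositional (_≟v_ {n G}) using (_∈?_)

  adj-sym : ∀ {a b} → Adj G a b → Adj G b a
  adj-sym {a} {b} p = trans (Graph.sym G b a) p

  -- Adjacency proofs are proofs of equality in Bool, hence unique.
  adj-irrelevant : ∀ {a b} (p q : Adj G a b) → p ≡ q
  adj-irrelevant = Decidable⇒UIP.≡-irrelevant Bool._≟_

  -- The vertex sequence of a walk; a walk is a path when this list is duplicate-free.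
  verts : ∀ {a b d} → Walk G a b d → List V
  verts (here {a}) = [ a ]
  verts (step {a} _ w) = a ∷ verts w

  length-verts : ∀ {a b d} (w : Walk G a b d) → length (verts w) ≡ suc d
  length-verts here = refl
  length-verts (step _ w) = cong suc (length-verts w)

  last∈verts : ∀ {a b d} (w : Walk G a b d) → b ∈ verts w
  last∈verts here = here refl
  last∈verts (step _ w) = there (last∈verts w)

  _++w_ : ∀ {a c b j k} → Walk G a c j → Walk G c b k → Walk G a b (j + k)
  here ++w w₂ = w₂
  step p w₁ ++w w₂ = step p (w₁ ++w w₂)

  _∷ʳw_ : ∀ {a c b d} → Walk G a c d → Adj G c b → Walk G a b (suc d)
  here ∷ʳw p = step p here
  step q w ∷ʳw p = step q (w ∷ʳw p)

  reverseW : ∀ {a b d} → Walk G a b d → Walk G b a d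
  reverseW here = here
  reverseW (step p w) = reverseW w ∷ʳw adj-sym p

  distinct⇒positive : ∀ {a b d} → Walk G a b d → b ≢ a → 1 ≤ d
  distinct⇒positive here b≢a = ⊥-elim (b≢a refl)
  distinct⇒positive (step _ _) _ = s≤s z≤n

  positive⇒distinct : ∀ {a b d} → 1 ≤ d → (w : Walk G a b d) → Unique (verts w) → b ≢ a
  positive⇒distinct (s≤s _) (step _ w) (a∉ ∷ _) b≡a = All.lookup a∉ (last∈verts w) (sym≡ b≡a)

  walk-chain : ∀ {a' a b d c} → Adj G a' a → (w : Walk G a b d) → Adj G b c → Linked (Adj G) (a' ∷ verts w ++ [ c ])
  walk-chain p here q = p ∷ q ∷ [-]
  walk-chain p (step p' w) q = p ∷ walk-chain p' w q

  chain⇒walk : ∀ {a} as {c} → Linked (Adj G) (a ∷ as ++ [ c ]) →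
    ∃ λ b → Σ (Walk G a b (length as)) λ w → verts w ≡ a ∷ as × Adj G b c
  chain⇒walk [] (p ∷ [-]) = _ , here , refl , p
  chain⇒walk {a} (a' ∷ as) (p ∷ l) with chain⇒walk as l
  ... | b , w , eq , q = b , step p w , cong (a ∷_) eq , q

  module _ {P : V → Set} where

    All-head : ∀ {a b d} (w : Walk G a b d) → All P (verts w) → P a
    All-head here (pa ∷ _) = pa
    All-head (step _ w) (pa ∷ _) = pa

    All-++w : ∀ {a c b j k} (w₁ : Walk G a c j) (w₂ : Walk G c b k) →
      All P (verts w₁) → All P (verts w₂) → All P (verts (w₁ ++w w₂))
    All-++w here w₂ _ all₂ = all₂
    All-++w (step p w₁) w₂ (pa ∷ all₁) all₂ = pa ∷ All-++w w₁ w₂ all₁ all₂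

    All-∷ʳw : ∀ {a c b d} (w : Walk G a c d) (p : Adj G c b) → All P (verts w) → P b → All P (verts (w ∷ʳw p))
    All-∷ʳw here p (pa ∷ []) pb = pa ∷ pb ∷ []
    All-∷ʳw (step q w) p (pa ∷ all) pb = pa ∷ All-∷ʳw w p all pb

    All-reverseW : ∀ {a b d} (w : Walk G a b d) → All P (verts w) → All P (verts (reverseW w))
    All-reverseW here all = all
    All-reverseW (step p w) (pa ∷ all) = All-∷ʳw (reverseW w) (adj-sym p) (All-reverseW w all) pa

  splitW : ∀ {a b} j k → (w : Walk G a b (j + k)) →
    ∃ λ c → Σ (Walk G a c j) λ w₁ → Σ (Walk G c b k) λ w₂ →
      (∀ {P : V → Set} → All P (verts w) → All P (verts w₁) × All P (verts w₂))
  splitW zero k w = _ , here , w , λ all → All-head w all ∷ [] , all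
  splitW (suc j) k (step p w) with splitW j k w
  ... | c , w₁ , w₂ , restrict = c , step p w₁ , w₂ , λ { (pa ∷ all) → (pa ∷ proj₁ (restrict all)) , proj₂ (restrict all) }

  splitAtVertex : ∀ {a b d v} (w : Walk G a b d) → v ∈ verts w →
    ∃ λ j → ∃ λ k → j + k ≡ d × Walk G a v j × Walk G v b k
  splitAtVertex here (here refl) = 0 , 0 , refl , here , here
  splitAtVertex (step p w) (here refl) = 0 , _ , refl , here , step p w
  splitAtVertex (step p w) (there m) with splitAtVertex w m
  ... | j , k , eq , w₁ , w₂ = suc j , k , cong suc eq , step p w₁ , w₂

  pathFrom : ∀ {a b d v} (w : Walk G a b d) → v ∈ verts w → Unique (verts w) →
    ∃ λ d' → d' ≤ d × Σ (Walk G v b d') λ w' → Unique (verts w') × verts w' ⊆ verts w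
  pathFrom here (here refl) u = 0 , z≤n , here , u , λ m → m
  pathFrom (step p w) (here refl) u = _ , ≤-refl , step p w , u , λ m → m
  pathFrom (step p w) (there m) (_ ∷ u) with pathFrom w m u
  ... | d' , d'≤d , w' , u' , sub = d' , m≤n⇒m≤1+n d'≤d , w' , u' , λ m' → there (sub m')

  pathWithin : ∀ {a b d} (w : Walk G a b d) →
    ∃ λ d' → d' ≤ d × Σ (Walk G a b d') λ w' → Unique (verts w') × verts w' ⊆ verts w
  pathWithin here = 0 , z≤n , here , [] ∷ [] , λ m → m
  pathWithin (step {a} p w) with pathWithin w
  ... | d' , d'≤d , w' , u , sub with a ∈? verts w'
  ...   | yes m with pathFrom w' m u
  ...     | d'' , d''≤d' , w'' , u' , sub' =
            d'' , m≤n⇒m≤1+n (≤-trans d''≤d' d'≤d) , w'' , u' , λ m' → there (sub (sub' m'))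
  pathWithin (step {a} p w) | d' , d'≤d , w' , u , sub | no a∉ =
    suc d' , s≤s d'≤d , step p w' , ¬Any⇒All¬ (verts w') a∉ ∷ u ,
    λ { (here refl) → here refl ; (there m') → there (sub m') }

  walk? : ∀ d a b → Dec (Walk G a b d)
  walk? zero a b with a ≟v b
  ... | yes refl = yes here
  ... | no a≢b = no λ { here → a≢b refl }
  walk? (suc d) a b with any? (λ c → adj? a c ×-dec walk? d c b)
  ... | yes (c , p , w) = yes (step p w)
  ... | no none = no λ { (step p w) → none (_ , p , w) }

  searchWalks : ∀ k a (P : ∀ {b} → Walk G a b k → Set) → (∀ {b} (w : Walk G a b k) → Dec (P w)) →
    Dec (∃ λ b → Σ (Walk G a b k) P)
  searchWalks zero a P P? with P? here
  ... | yes p = yes (a , here , p)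
  ... | no ¬p = no λ { (_ , here , p) → ¬p p }
  searchWalks (suc k) a P P? with any? firstStep
    where
    firstStep : ∀ c → Dec (Σ (Adj G a c) λ e → ∃ λ b → Σ (Walk G c b k) (λ w → P (step e w)))
    firstStep c with adj? a c
    ... | no ¬e = no λ { (e , _) → ¬e e }
    ... | yes e with searchWalks k c (λ w → P (step e w)) (λ w → P? (step e w))
    ...   | yes (b , w , p) = yes (e , b , w , p)
    ...   | no none = no λ { (e' , b , w , p) → none (b , w , subst (λ e'' → P (step e'' w)) (adj-irrelevant e' e) p) }
  ... | yes (c , e , b , w , p) = yes (b , step e w , p)
  ... | no none = no λ { (b , step e w , p) → none (_ , e , b , w , p) }

  module _ (u : V) where

    walk⇒ball : ∀ {v d i} → Walk G u v d → d ≤ i → Ball G u i v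
    walk⇒ball {v} {d} w d≤i with least (λ k → walk? k u v) w
    ... | m , m≤d , shortest = m , ≤-trans m≤d d≤i , proj₁ shortest , λ d' w' → least-≤ shortest w'

    far-walk-outside : ∀ {i q p k} (w : Walk G q p k) → (∀ d → Walk G u p d → i + suc k ≤ d) →
      All (λ v → ¬ Ball G u i v) (verts w)
    far-walk-outside {i} {k = k} w far = All.tabulate outside
      where
      outside : ∀ {v} → v ∈ verts w → ¬ Ball G u i v
      outside v∈w (d , d≤i , (uv , _)) with splitAtVertex w v∈w
      ... | j , j' , j+j'≡k , _ , vp = <-irrefl refl (begin-strict
        i + k    <⟨ +-monoʳ-< i (n<1+n k) ⟩
        i + suc k ≤⟨ far (d + j') (uv ++w vp) ⟩
        d + j'   ≤⟨ +-mono-≤ d≤i (subst (j' ≤_) j+j'≡k (m≤n+m j' j)) ⟩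
        i + k    ∎)
        where open ≤-Reasoning

    ball? : ∀ i v → Dec (Ball G u i v)
    ball? i v with searchUpTo (λ k → walk? k u v) i
    ... | inj₁ (m , m≤i , shortest) = yes (m , m≤i , proj₁ shortest , λ d' w' → least-≤ shortest w')
    ... | inj₂ none = no λ { (d , d≤i , (w , _)) → none d d≤i w }

module Escapes (G : Graph) (S : Vertex G → Set) (S? : ∀ v → Dec (S v))
               {x y : Vertex G} (xy : Adj G x y) (Sx : S x) (¬Sy : ¬ S y) where

  open Walks G
  open import Data.List.Relation.Unary.Unique.DecPropositional (_≟v_ {n G}) using (unique?)

  Outside : V → Set
  Outside v = ¬ S v

  EarShape : V → List V → V → Set
  EarShape s inner e = (s ≢ e × Unique (s ∷ inner ++ [ e ])) ⊎ (s ≡ e × Unique (s ∷ inner) × 2 ≤ length inner)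

  ear-inner-unique : ∀ {s inner e} → EarShape s inner e → Unique inner
  ear-inner-unique {inner = inner} (inj₁ (_ , _ ∷ u)) = unique-++ˡ inner u
  ear-inner-unique (inj₂ (_ , _ ∷ u , _)) = u

  ear-proper : ∀ {s inner e} → EarShape s inner e → s ≢ e ⊎ 2 ≤ length inner
  ear-proper (inj₁ (s≢e , _)) = inj₁ s≢e
  ear-proper (inj₂ (_ , _ , long)) = inj₂ long

  -- w : y ⇝ t of length k is an escape when it is a path outside S and t has a neighbour z ∈ S;
  -- z = x is allowed only for k ≥ 1, so that x, w, z is an ear (a closed ear needs three edges).
  IsEscape : ∀ k {t} → Walk G y t k → Set
  IsEscape k {t} w = Unique (verts w) × All Outside (verts w) × ∃ λ z → Adj G t z × S z × (x ≢ z ⊎ 1 ≤ k)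

  Escape : ℕ → Set
  Escape k = ∃ λ t → Σ (Walk G y t k) (IsEscape k)

  escape? : ∀ k → Dec (Escape k)
  escape? k = searchWalks k y (IsEscape k) isEscape?
    where
    isEscape? : ∀ {t} (w : Walk G y t k) → Dec (IsEscape k w)
    isEscape? {t} w = unique? (verts w) ×-dec All.all? (λ v → ¬? (S? v)) (verts w) ×-dec
                      any? (λ z → adj? t z ×-dec S? z ×-dec (¬? (x ≟v z) ⊎-dec (1 ≤? k)))

  walk⇒escape : ∀ {t s d} (w : Walk G y t d) → All Outside (verts w) → Adj G t s → S s →
    ¬ (t ≡ y × s ≡ x) → ∃ λ k → k ≤ d × Escape k
  walk⇒escape {t} {s} w out ts Ss notLeg with pathWithin w
  ... | k , k≤d , p , unique , p⊆w = k , k≤d , t , p , unique , anti-mono p⊆w out , s , ts , Ss , proper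
    where
    proper : x ≢ s ⊎ 1 ≤ k
    proper with x ≟v s
    ... | no x≢s = inj₁ x≢s
    ... | yes refl = inj₂ (distinct⇒positive p (λ t≡y → notLeg (t≡y , refl)))

  -- An escape w with exit z yields the ear x, w, z of length k + 2.
  escape⇒ear : ∀ {k} → Escape k → ∃ λ P → IsEar G S P × ContainsEdge P x y × pathLength P ≡ suc (suc k)
  escape⇒ear {k} (t , w , unique , out , z , tz , Sz , proper) =
    mkPath x (verts w) z , (walk-chain xy w tz , Sx , Sz , out , shape) , leg-first w , cong suc (length-verts w)
    where
    x∉w : All (x ≢_) (verts w)
    x∉w = All.map (λ ¬Sv x≡v → ¬Sv (subst S x≡v Sx)) out
    shape : EarShape x (verts w) z
    shape with x ≟v z
    ... | no x≢z = inj₁ (x≢z , All-++⁺ x∉w (x≢z ∷ [])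
                                ∷ unique-++⁺ unique ([] ∷ []) λ { (m , here refl) → All.lookup out m Sz })
    ... | yes refl = inj₂ (refl , x∉w ∷ unique ,
                          subst (2 ≤_) (sym≡ (length-verts w)) (s≤s ([ (λ x≢x → ⊥-elim (x≢x refl)) , (λ k≥1 → k≥1) ]′ proper)))
    leg-first : ∀ {d} (w : Walk G y t d) → ContainsEdge {G} (mkPath x (verts w) z) x y
    leg-first here = hd (inj₁ (refl , refl))
    leg-first (step _ _) = hd (inj₁ (refl , refl))

  -- Only the boundary edges of an S-ear touch S, so the leg is its first or its last edge.
  leg-position : ∀ {s e} inner → S s → S e → All Outside inner → HasEdge x y (s ∷ inner ++ [ e ]) →
    (s ≡ x × ∃ λ rs → inner ≡ y ∷ rs) ⊎ (e ≡ x × ∃ λ rs → inner ≡ rs ++ [ y ])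
  leg-position [] Ss Se _ (hd (inj₁ (_ , refl))) = ⊥-elim (¬Sy Se)
  leg-position (_ ∷ rs) Ss Se _ (hd (inj₁ (s≡x , refl))) = inj₁ (s≡x , rs , refl)
  leg-position [] Ss Se _ (hd (inj₂ (refl , _))) = ⊥-elim (¬Sy Ss)
  leg-position (_ ∷ _) Ss Se _ (hd (inj₂ (refl , _))) = ⊥-elim (¬Sy Ss)
  leg-position [] Ss Se _ (tl (tl ()))
  leg-position (a ∷ as) Ss Se (¬Sa ∷ out) (tl leg) = inj₂ (leg-last a as ¬Sa out leg)
    where
    leg-last : ∀ a as {e} → Outside a → All Outside as → HasEdge x y (a ∷ as ++ [ e ]) →
      e ≡ x × ∃ λ rs → a ∷ as ≡ rs ++ [ y ]
    leg-last a [] ¬Sa _ (hd (inj₁ (refl , _))) = ⊥-elim (¬Sa Sx)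
    leg-last a (_ ∷ _) ¬Sa _ (hd (inj₁ (refl , _))) = ⊥-elim (¬Sa Sx)
    leg-last a [] _ _ (hd (inj₂ (refl , refl))) = refl , [] , refl
    leg-last a (_ ∷ _) _ (¬Sb ∷ _) (hd (inj₂ (refl , refl))) = ⊥-elim (¬Sb Sx)
    leg-last a [] _ _ (tl (tl ()))
    leg-last a (b ∷ bs) _ (¬Sb ∷ out) (tl leg) with leg-last b bs ¬Sb out leg
    ... | e≡x , rs , eq = e≡x , a ∷ rs , cong (a ∷_) eq

  oriented-ear⇒escape : ∀ rs {z} → Linked (Adj G) (x ∷ y ∷ rs ++ [ z ]) → Unique (y ∷ rs) → All Outside (y ∷ rs) →
    S z → (x ≢ z ⊎ 1 ≤ length rs) → Escape (length rs)
  oriented-ear⇒escape rs {z} (_ ∷ chain) unique out Sz proper with chain⇒walk rs chain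
  ... | t , w , verts≡ , tz = t , w , subst Unique (sym≡ verts≡) unique , subst (All Outside) (sym≡ verts≡) out , z , tz , Sz , proper

  -- Every S-ear through the leg arises from an escape, read in one of its two directions.
  ear⇒escape : ∀ Q → IsEar G S Q → ContainsEdge Q x y → ∃ λ k → Escape k × suc (suc k) ≡ pathLength Q
  ear⇒escape (mkPath s inner e) (chain , Ss , Se , out , shape) leg with leg-position inner Ss Se out leg
  ... | inj₁ (refl , rs , refl) = length rs , oriented-ear⇒escape rs chain (ear-inner-unique shape) out Se proper , refl
    where
    proper : x ≢ e ⊎ 1 ≤ length rs
    proper = [ inj₁ , (λ long → inj₂ (≤-pred long)) ]′ (ear-proper shape)
  ... | inj₂ (refl , rs , refl) =
      length (reverse rs) , oriented-ear⇒escape (reverse rs) chain' unique' out' Ss proper' , len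
    where
    reversed : reverse (s ∷ (rs ++ [ y ]) ++ [ x ]) ≡ x ∷ y ∷ reverse rs ++ [ s ]
    reversed = trans (reverse-∷-∷ʳ s (rs ++ [ y ]) x) (cong (λ l → x ∷ l ++ [ s ]) (reverse-++ rs [ y ]))
    chain' : Linked (Adj G) (x ∷ y ∷ reverse rs ++ [ s ])
    chain' = subst (Linked (Adj G)) reversed (linked-reverse adj-sym _ chain)
    unique' : Unique (y ∷ reverse rs)
    unique' = subst Unique (reverse-++ rs [ y ]) (unique-reverse _ (ear-inner-unique shape))
    out' : All Outside (y ∷ reverse rs)
    out' = subst (All Outside) (reverse-++ rs [ y ]) (all-reverse _ out)
    proper' : x ≢ s ⊎ 1 ≤ length (reverse rs)
    proper' = [ (λ s≢x → inj₁ (λ x≡s → s≢x (sym≡ x≡s))) ,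
                (λ long → inj₂ (subst (1 ≤_) (sym≡ (length-reverse rs)) (≤-pred (subst (2 ≤_) (length-∷ʳ rs y) long)))) ]′
              (ear-proper shape)
    len : suc (suc (length (reverse rs))) ≡ suc (length (rs ++ [ y ]))
    len = cong suc (trans (cong suc (length-reverse rs)) (sym≡ (length-∷ʳ rs y)))

  -- Following a chain a, L, x from a vertex a outside S, stop just before the first vertex of S.
  first-entry : ∀ a L → Outside a → Linked (Adj G) (a ∷ L ++ [ x ]) →
    ∃ λ t → ∃ λ d → d ≤ length L × Σ (Walk G a t d) λ w →
      All Outside (verts w) × t ∈ a ∷ L × ∃ λ s → Adj G t s × S s
  first-entry a [] ¬Sa (p ∷ [-]) = a , 0 , z≤n , here , ¬Sa ∷ [] , here refl , x , p , Sx
  first-entry a (b ∷ L) ¬Sa (p ∷ chain) with S? b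
  ... | yes Sb = a , 0 , z≤n , here , ¬Sa ∷ [] , here refl , b , p , Sb
  ... | no ¬Sb with first-entry b L ¬Sb chain
  ...   | t , d , d≤L , w , out , t∈ , s , ts , Ss = t , suc d , s≤s d≤L , step p w , ¬Sa ∷ out , there t∈ , s , ts , Ss

  -- A path y, M, x (M nonempty) yields an escape no longer than M: its part before it first enters S.
  path⇒escape : ∀ M → 1 ≤ length M → Linked (Adj G) (y ∷ M ++ [ x ]) → Unique (y ∷ M ++ [ x ]) →
    ∃ λ k → k ≤ length M × Escape k
  path⇒escape [] () _ _
  path⇒escape (b ∷ M) _ (p ∷ chain) (_ ∷ b∉ ∷ _) with S? b
  ... | yes Sb with walk⇒escape here (¬Sy ∷ []) p Sb (λ { (_ , refl) → All.lookup b∉ (∈-++⁺ʳ M (here refl)) refl })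
  ...   | k , k≤0 , escape = k , ≤-trans k≤0 z≤n , escape
  path⇒escape (b ∷ M) _ (p ∷ chain) (y∉ ∷ _) | no ¬Sb with first-entry b M ¬Sb chain
  ... | t , d , d≤M , w , out , t∈ , s , ts , Ss
        with walk⇒escape (step p w) (¬Sy ∷ out) ts Ss (λ { (refl , _) → All.lookup y∉ (∈-++⁺ˡ t∈) refl })
  ...   | k , k≤1+d , escape = k , ≤-trans k≤1+d (s≤s d≤M) , escape

  -- A cycle through the leg, read from y around to x, is such a path.
  cycle⇒path : ∀ C → IsCycle G C → ContainsEdge C x y →
    ∃ λ M → Linked (Adj G) (y ∷ M ++ [ x ]) × Unique (y ∷ M ++ [ x ]) × suc (length M) ≡ length (inner C)
  cycle⇒path (mkPath c inner .c) (chain , refl , unique , long) leg with edge-split leg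
  ... | ys , zs , a , b , split , same with rotate-closed c inner ys zs a b (≤-trans (s≤s z≤n) long) chain unique split | same
  ...   | M , chain' , unique' , len | inj₁ (refl , refl) = M , chain' , unique' , len
  ...   | M , chain' , unique' , len | inj₂ (refl , refl) =
          reverse M , subst (Linked (Adj G)) reversed (linked-reverse adj-sym _ chain') ,
          subst Unique reversed (unique-reverse _ unique') , trans (cong suc (length-reverse M)) len
    where
    reversed : reverse (x ∷ M ++ [ y ]) ≡ y ∷ reverse M ++ [ x ]
    reversed = reverse-∷-∷ʳ x M y

  cycle⇒escape : ∀ h → EveryEdgeOnCycleAtMost G h → ∃ λ k → Escape k × suc (suc k) ≤ h
  cycle⇒escape h short-cycles with short-cycles x y xy
  ... | C , cycle@(_ , _ , _ , long) , leg , |C|≤h with cycle⇒path C cycle leg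
  ...   | M , chain , unique , len with path⇒escape M (≤-pred (subst (2 ≤_) (sym≡ len) long)) chain unique
  ...     | k , k≤M , escape = k , escape , ≤-trans (s≤s (s≤s k≤M)) (subst (λ m → suc m ≤ h) (sym≡ len) |C|≤h)

  optimal-ear : ∀ {k} → Least Escape k → ∃ λ P → IsOptimalEar G S x y P × pathLength P ≡ suc (suc k)
  optimal-ear (escape , shortest) with escape⇒ear escape
  ... | P , ear , leg , |P|≡k+2 = P , (ear , leg , optimal) , |P|≡k+2
    where
    optimal : ∀ Q → IsEar G S Q → ContainsEdge Q x y → pathLength P ≤ pathLength Q
    optimal Q ear' leg' with ear⇒escape Q ear' leg'
    ... | k' , escape' , |Q|≡k'+2 =
          subst₂ _≤_ (sym≡ |P|≡k+2) |Q|≡k'+2 (s≤s (s≤s (least-≤ (escape , shortest) escape')))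

-- Let u have eccentricity r, let i < r and S = N_i[u], and put m = r − i.
-- Every vertex outside S lies fewer than m steps beyond S, which forces a shortest escape to be
-- shorter than 2m: otherwise its vertex at position m could be reached from S by a shortcut.
module RadiusBound (G : Graph) {u : Vertex G} {r : ℕ} (ecc : Ecc G u r) {i : ℕ} (i<r : i < r)
                   {x y : Vertex G} (xy : Adj G x y) (Sx : Ball G u i x) (¬Sy : ¬ Ball G u i y) where

  open Walks G

  S : Vertex G → Set
  S = Ball G u i

  open Escapes G S (ball? u i) xy Sx ¬Sy

  m : ℕ
  m = r ∸ i

  1≤m : 1 ≤ m
  1≤m = m<n⇒0<n∸m i<r

  -- Every vertex p outside S is reached from some s ∈ S by an edge s q followed by a walk q ⇝ p
  -- outside S of length below m: the end of a shortest walk from u to p.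
  approach : ∀ {p} → Outside p →
    ∃ λ s → ∃ λ q → ∃ λ o → S s × Adj G s q × suc o ≤ m × Σ (Walk G q p o) (λ w → All Outside (verts w))
  approach {p} ¬Sp with proj₁ ecc p
  ... | d , (up , shortest) , d≤r with d ≤? i
  ...   | yes d≤i = ⊥-elim (¬Sp (d , d≤i , (up , shortest)))
  ...   | no d≰i with m≤n⇒∃[o]m+o≡n (≰⇒> d≰i)
  ...     | o , refl with splitW i (suc o) (subst (Walk G u p) (sym≡ (+-suc i o)) up)
  ...       | s , us , step sq qp , _ =
              s , _ , o , walk⇒ball u us ≤-refl , sq ,
              +-cancelˡ-≤ i (suc o) m (subst₂ _≤_ (sym≡ (+-suc i o)) (sym≡ (m+[n∸m]≡n (<⇒≤ i<r))) d≤r) ,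
              qp , far-walk-outside u qp (λ d' up' → subst (_≤ d') (sym≡ (+-suc i o)) (shortest d' up'))

  -- A shortest escape of length at least m has length below 2m. Split it at its vertex p at position m
  -- and approach p from S as above via an edge s q; this gives a shorter escape if s q is the leg, and
  -- otherwise the escape y ⇝ p ⇝ q followed by q s, of length below 2m.
  long-escape-bound : ∀ k₂ → Least Escape (m + k₂) → suc (m + k₂) ≤ 2 * m
  long-escape-bound k₂ (escape@(t , w , unique , out , z , tz , Sz , _) , shortest) with splitW m k₂ w
  ... | p , yp , pt , restrict with approach (All-head pt (proj₂ (restrict out)))
  ...   | s , q , o , Ss , sq , o<m , qp , qp-out with q ≟v y ×-dec s ≟v x
  ...     | yes (refl , refl) =
    let k' , k'≤o+k₂ , escape' = walk⇒escape (qp ++w pt) (All-++w qp pt qp-out (proj₂ (restrict out))) tz Sz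
                                   (λ leg → positive⇒distinct (≤-trans 1≤m (m≤m+n m k₂)) w unique (proj₁ leg))
    in ⊥-elim (<⇒≱ o<m (+-cancelʳ-≤ k₂ m o (≤-trans (least-≤ (escape , shortest) escape') k'≤o+k₂)))
  ...     | no notLeg =
    let k' , k'≤m+o , escape' = walk⇒escape (yp ++w reverseW qp)
                                  (All-++w yp (reverseW qp) (proj₁ (restrict out)) (All-reverseW qp qp-out)) (adj-sym sq) Ss notLeg
    in begin-strict
         m + k₂ ≤⟨ least-≤ (escape , shortest) escape' ⟩
         k'     ≤⟨ k'≤m+o ⟩
         m + o  <⟨ +-monoʳ-< m o<m ⟩
         m + m  ≡⟨ cong (m +_) (sym≡ (+-identityʳ m)) ⟩
         2 * m  ∎
    where open ≤-Reasoning

  radius-bound : ∀ {k} → Least Escape k → suc k ≤ 2 * m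
  radius-bound {k} shortest with suc k ≤? 2 * m
  ... | yes k<2m = k<2m
  ... | no k≮2m with m≤n⇒∃[o]m+o≡n (≤-trans (m≤m+n m (m + 0)) (≤-pred (≰⇒> k≮2m)))
  ...   | k₂ , refl = long-escape-bound k₂ shortest

lemma3 : (G : Graph) → Connected G → Bridgeless G →
    (r : ℕ) → IsRadius G r → (u : Vertex G) → Ecc G u r →
    (h : ℕ) → IsEta G h →
    (i : ℕ) → i < r →
    (x y : Vertex G) → IsLeg G (Ball G u i) x y →
    ∃ λ P → IsOptimalEar G (Ball G u i) x y P × pathLength P ≤ (suc (2 * (r ∸ i)) ⊓ h)
lemma3 G _ _ r _ u ecc h (short-cycles , _) i i<r x y (xy , Sx , ¬Sy) = bounded-optimal-ear
  where
  open Walks G using (ball?)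
  open Escapes G (Ball G u i) (ball? u i) xy Sx ¬Sy
  open RadiusBound G ecc i<r xy Sx ¬Sy using (radius-bound)

  bounded-optimal-ear : ∃ λ P → IsOptimalEar G (Ball G u i) x y P × pathLength P ≤ (suc (2 * (r ∸ i)) ⊓ h)
  bounded-optimal-ear with cycle⇒escape h short-cycles
  ... | k₀ , escape₀ , k₀+2≤h with least escape? escape₀
  ...   | k , k≤k₀ , shortest with optimal-ear shortest
  ...     | P , optimal , |P|≡k+2 =
            P , optimal , subst (_≤ suc (2 * (r ∸ i)) ⊓ h) (sym≡ |P|≡k+2)
                            (⊓-glb (s≤s (radius-bound shortest)) (≤-trans (s≤s (s≤s k≤k₀)) k₀+2≤h))
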